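{- Let $(A,B)$ be a suitable pair of $k$-tuples, $A=(a_1,\dots,a_k)$, $B=(b_1,\dots,b_k)$. Then the compound sequence $G(A,B)$ is smooth with $c$ values $(a_1,\dots,a_k)$.
   Context: $A,B\in\mathbb{N}^k$ (positive integers) form a suitable pair if $\gcd(a_i,b_j)=1$ for all $i\ge j$; then $g_i=b_1\cdots b_i\,a_{i+1}\cdots a_k$ for $0\le i\le k$ and $G(A,B)=(g_0,\dots,g_k)$ is the compound sequence. For a sequence $H=(h_0,\dots,h_k)$ of positive integers, let $d_i=\gcd(h_0,\dots,h_i)$ and $c_i=d_{i-1}/d_i$ for $1\le i\le k$ (the $c$ values of $H$); $H$ is smooth if $c_ih_i\in\langle h_0,\dots,h_{i-1}\rangle$ for $1\le i\le k$, where $\langle\cdot\rangle$ denotes the set of finite non-negative integer linear combinations. -}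

module Defs where

open import Data.Nat using (ℕ; zero; suc; _+_; _*_; _/_; _≤_; NonZero)
open import Data.Nat.GCD using (gcd)
open import Data.Nat.Divisibility using (_∣_)
open import Data.Fin using (Fin; zero; suc; toℕ; inject₁; inject≤)
open import Data.Fin.Properties using (toℕ<n)
open import Data.Nat.Properties using (<⇒≤)
open import Data.Product using (Σ; _×_)
open import Relation.Binary.PropositionalEquality using (_≡_)

-- Tuples are functions out of Fin.  A k-tuple (a_1,…,a_k) is  a : Fin k → ℕ
-- with a_i = a (i-1) (0-based Fin index).  A sequence (h_0,…,h_k) is
-- h : Fin (suc k) → ℕ with h_i = h i.

Positive : ∀ {n} → (Fin n → ℕ) → Set
Positive {n} f = (i : Fin n) → NonZero (f i)

Coprime : ℕ → ℕ → Set
Coprime m n = gcd m n ≡ 1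

Suitable : ∀ k → (Fin k → ℕ) → (Fin k → ℕ) → Set
Suitable k a b = (i j : Fin k) → toℕ j ≤ toℕ i → Coprime (a i) (b j)

prodFirst : ∀ {k} → (Fin k → ℕ) → ℕ → ℕ
prodFirst {zero} f i = 1
prodFirst {suc k} f zero = 1
prodFirst {suc k} f (suc i) = f zero * prodFirst {k} (λ j → f (suc j)) i

prodAfter : ∀ {k} → (Fin k → ℕ) → ℕ → ℕ
prodAfter {zero} f i = 1
prodAfter {suc k} f zero = f zero * prodAfter {k} (λ j → f (suc j)) zero
prodAfter {suc k} f (suc i) = prodAfter {k} (λ j → f (suc j)) i

compound : ∀ k → (Fin k → ℕ) → (Fin k → ℕ) → Fin (suc k) → ℕ
compound k a b i = prodFirst b (toℕ i) * prodAfter a (toℕ i)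

dval : ∀ {k} → (Fin (suc k) → ℕ) → Fin (suc k) → ℕ
dval h zero = h zero
dval {suc k} h (suc i) = gcd (dval {k} (λ j → h (inject₁ j)) i) (h (suc i))

-- natural division with the (irrelevant here) convention x / 0 = 0
_div_ : ℕ → ℕ → ℕ
x div zero = 0
x div suc n = x / suc n

-- c_i = d_{i-1} / d_i  for 1 ≤ i ≤ k; indexed by j : Fin k with i = j + 1
cval : ∀ {k} → (Fin (suc k) → ℕ) → Fin k → ℕ
cval h j = dval h (inject₁ j) div dval h (suc j)

sumFin : ∀ {n} → (Fin n → ℕ) → ℕ
sumFin {zero} f = 0
sumFin {suc n} f = f zero + sumFin (λ j → f (suc j))

InSemigroup : ℕ → ∀ {n} → (Fin n → ℕ) → Set
InSemigroup x {n} gens = Σ (Fin n → ℕ) λ coeff → sumFin (λ j → coeff j * gens j) ≡ x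

prefix : ∀ {k} → (Fin (suc k) → ℕ) → (i : Fin (suc k)) → Fin (toℕ i) → ℕ
prefix h i l = h (inject≤ l (<⇒≤ (toℕ<n i)))

Smooth : ∀ k → (Fin (suc k) → ℕ) → Set
Smooth k h = (j : Fin k) → InSemigroup (cval h j * h (suc j)) (prefix h (suc j))

module Submission where

-- Write P_i = b_1⋯b_i and S_i = a_{i+1}⋯a_k, so g_i = P_i · S_i and
-- S_{i-1} = a_i · S_i.  The heart of the proof is the prefix-gcd formula
--     d_i = gcd(g_0, …, g_i) = S_i,
-- proved by induction on i:  d_i = gcd(S_{i-1}, g_i) = gcd(a_i·S_i, P_i·S_i)
-- = S_i, because a_i is coprime to every b_j with j ≤ i, hence to P_i.
-- Dividing gives c_i = S_{i-1} / S_i = a_i.  Smoothness is then immediate: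
-- c_i·g_i = a_i·P_i·S_i = b_i·P_{i-1}·a_i·S_i = b_i·g_{i-1}, a multiple of a
-- single earlier generator, hence in ⟨g_0, …, g_{i-1}⟩.

open import Defs
open import Data.Nat using (ℕ; zero; suc; _+_; _*_; _<_; s≤s; z≤n; NonZero)
open import Data.Nat.Properties using (+-identityʳ; *-identityˡ; *-identityʳ; *-comm; *-assoc; m*n≢0; suc-injective; ≤-pred; <⇒≤)
open import Data.Nat.GCD using (gcd; c*gcd[m,n]≡gcd[cm,cn])
open import Data.Nat.Coprimality as Coprimality using (coprime⇒gcd≡1; gcd≡1⇒coprime; coprime-divisor)
open import Data.Nat.Divisibility using (∣-trans; ∣1⇒≡1)
open import Data.Nat.DivMod using (m*n/n≡m)
open import Data.Nat.Tactic.RingSolver using (solve-∀)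
open import Data.Fin using (Fin; zero; suc; toℕ; inject₁; inject≤; fromℕ)
open import Data.Fin.Properties using (toℕ-inject₁; toℕ-inject≤; toℕ-fromℕ; toℕ<n)
open import Data.Product using (_×_; _,_)
open import Relation.Binary.PropositionalEquality using (_≡_; refl; sym; trans; cong; cong₂; module ≡-Reasoning)
open ≡-Reasoning

prodFirst-zero : ∀ {k} (f : Fin k → ℕ) → prodFirst f 0 ≡ 1
prodFirst-zero {zero} f = refl
prodFirst-zero {suc k} f = refl

prodFirst-suc : ∀ {k} (f : Fin k → ℕ) (j : Fin k) →
  prodFirst f (suc (toℕ j)) ≡ prodFirst f (toℕ j) * f j
prodFirst-suc {suc k} f zero =
  trans (cong (f zero *_) (prodFirst-zero (λ l → f (suc l)))) (*-comm (f zero) 1)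
prodFirst-suc {suc k} f (suc j) = begin
  f zero * prodFirst (λ l → f (suc l)) (suc (toℕ j))
    ≡⟨ cong (f zero *_) (prodFirst-suc (λ l → f (suc l)) j) ⟩
  f zero * (prodFirst (λ l → f (suc l)) (toℕ j) * f (suc j))
    ≡⟨ sym (*-assoc (f zero) _ _) ⟩
  f zero * prodFirst (λ l → f (suc l)) (toℕ j) * f (suc j) ∎

prodAfter-step : ∀ {k} (f : Fin k → ℕ) (j : Fin k) →
  prodAfter f (toℕ j) ≡ f j * prodAfter f (suc (toℕ j))
prodAfter-step {suc k} f zero = refl
prodAfter-step {suc k} f (suc j) = prodAfter-step (λ l → f (suc l)) j

prodAfter-nonZero : ∀ {k} (f : Fin k → ℕ) → Positive f → ∀ n → NonZero (prodAfter f n)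
prodAfter-nonZero {zero} f pos n = _
prodAfter-nonZero {suc k} f pos zero =
  m*n≢0 (f zero) _ {{pos zero}} {{prodAfter-nonZero (λ l → f (suc l)) (λ l → pos (suc l)) zero}}
prodAfter-nonZero {suc k} f pos (suc n) = prodAfter-nonZero (λ l → f (suc l)) (λ l → pos (suc l)) n

coprime-1 : ∀ x → Coprimality.Coprime x 1
coprime-1 x (_ , d∣1) = ∣1⇒≡1 d∣1

coprime-* : ∀ {x y z} → Coprimality.Coprime x y → Coprimality.Coprime x z →
  Coprimality.Coprime x (y * z)
coprime-* {x} {y} {z} x⊥y x⊥z {d} (d∣x , d∣yz) = x⊥z (d∣x , coprime-divisor d⊥y d∣yz)
  where
  d⊥y : Coprimality.Coprime d y
  d⊥y (e∣d , e∣y) = x⊥y (∣-trans e∣d d∣x , e∣y)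

coprime-prodFirst : ∀ {k} x (f : Fin k → ℕ) n →
  (∀ l → toℕ l < n → Coprimality.Coprime x (f l)) → Coprimality.Coprime x (prodFirst f n)
coprime-prodFirst {zero} x f n hyp = coprime-1 x
coprime-prodFirst {suc k} x f zero hyp = coprime-1 x
coprime-prodFirst {suc k} x f (suc n) hyp =
  coprime-* (hyp zero (s≤s z≤n))
            (coprime-prodFirst x (λ l → f (suc l)) n (λ l l<n → hyp (suc l) (s≤s l<n)))

gcd-common-factor : ∀ x y Q → gcd x y ≡ 1 → gcd (x * Q) (y * Q) ≡ Q
gcd-common-factor x y Q x⊥y = begin
  gcd (x * Q) (y * Q) ≡⟨ cong₂ gcd (*-comm x Q) (*-comm y Q) ⟩
  gcd (Q * x) (Q * y) ≡⟨ sym (c*gcd[m,n]≡gcd[cm,cn] Q x y) ⟩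
  Q * gcd x y         ≡⟨ cong (Q *_) x⊥y ⟩
  Q * 1               ≡⟨ *-identityʳ Q ⟩
  Q                   ∎

dval-inject₁ : ∀ {k} (h : Fin (suc (suc k)) → ℕ) (j : Fin (suc k)) →
  dval h (inject₁ j) ≡ dval (λ l → h (inject₁ l)) j
dval-inject₁ h zero = refl
dval-inject₁ {suc k} h (suc j) =
  cong (λ d → gcd d (h (suc (inject₁ j)))) (dval-inject₁ (λ l → h (inject₁ l)) j)

dval-suc : ∀ {k} (h : Fin (suc k) → ℕ) (j : Fin k) →
  dval h (suc j) ≡ gcd (dval h (inject₁ j)) (h (suc j))
dval-suc {suc k} h j = cong (λ d → gcd d (h (suc j))) (sym (dval-inject₁ h j))

compound-shift : ∀ k (a b : Fin k → ℕ) (j : Fin k) →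
  a j * compound k a b (suc j) ≡ b j * compound k a b (inject₁ j)
compound-shift k a b j = begin
  a j * (prodFirst b (suc t) * S)   ≡⟨ cong (λ p → a j * (p * S)) (prodFirst-suc b j) ⟩
  a j * ((P * b j) * S)             ≡⟨ rearrange (a j) (b j) P S ⟩
  b j * (P * (a j * S))             ≡⟨ cong (λ s → b j * (P * s)) (sym (prodAfter-step a j)) ⟩
  b j * (P * prodAfter a t)         ≡⟨ cong (λ i → b j * (prodFirst b i * prodAfter a i)) (sym (toℕ-inject₁ j)) ⟩
  b j * compound k a b (inject₁ j)  ∎
  where
  t : ℕ
  t = toℕ j
  P : ℕ
  P = prodFirst b t
  S : ℕ
  S = prodAfter a (suc t)
  rearrange : ∀ (x y p s : ℕ) → x * ((p * y) * s) ≡ y * (p * (x * s))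
  rearrange = solve-∀

module _ (k : ℕ) (a b : Fin k → ℕ) (suitable : Suitable k a b) where

  dval-compound : ∀ n (i : Fin (suc k)) → toℕ i ≡ n → dval (compound k a b) i ≡ prodAfter a n
  dval-compound zero zero refl =
    trans (cong (_* prodAfter a 0) (prodFirst-zero b)) (*-identityˡ (prodAfter a 0))
  dval-compound (suc n) (suc j) i≡1+n = begin
    dval g (suc j)                                  ≡⟨ dval-suc g j ⟩
    gcd (dval g (inject₁ j)) (g (suc j))            ≡⟨ cong (λ d → gcd d (g (suc j))) previous ⟩
    gcd (a j * prodAfter a (suc t)) (g (suc j))     ≡⟨ gcd-common-factor (a j) _ _ aj⊥P ⟩
    prodAfter a (suc t)                             ≡⟨ cong (λ m → prodAfter a (suc m)) j≡n ⟩
    prodAfter a (suc n)                             ∎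
    where
    g : Fin (suc k) → ℕ
    g = compound k a b
    t : ℕ
    t = toℕ j
    j≡n : t ≡ n
    j≡n = suc-injective i≡1+n
    previous : dval g (inject₁ j) ≡ a j * prodAfter a (suc t)
    previous = trans (dval-compound n (inject₁ j) (trans (toℕ-inject₁ j) j≡n))
                     (trans (cong (prodAfter a) (sym j≡n)) (prodAfter-step a j))
    -- suitability: a_{j+1} is coprime to b_1, …, b_{j+1}
    aj⊥P : gcd (a j) (prodFirst b (suc t)) ≡ 1
    aj⊥P = coprime⇒gcd≡1 (coprime-prodFirst (a j) b (suc t)
             (λ l l≤j → gcd≡1⇒coprime (suitable j l (≤-pred l≤j))))

  cval-compound : Positive a → (j : Fin k) → cval (compound k a b) j ≡ a j
  cval-compound pos j = begin
    dval g (inject₁ j) div dval g (suc j)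
      ≡⟨ cong₂ _div_ (dval-compound t (inject₁ j) (toℕ-inject₁ j)) (dval-compound (suc t) (suc j) refl) ⟩
    prodAfter a t div S
      ≡⟨ cong (_div S) (prodAfter-step a j) ⟩
    (a j * S) div S
      ≡⟨ cancel (a j) S {{prodAfter-nonZero a pos (suc t)}} ⟩
    a j ∎
    where
    g : Fin (suc k) → ℕ
    g = compound k a b
    t : ℕ
    t = toℕ j
    S : ℕ
    S = prodAfter a (suc t)
    cancel : ∀ x Q → {{NonZero Q}} → (x * Q) div Q ≡ x
    cancel x (suc q) = m*n/n≡m x (suc q)

multiple∈semigroup : ∀ {n} (gens : Fin n → ℕ) (l : Fin n) (m : ℕ) → InSemigroup (m * gens l) gens
multiple∈semigroup {suc n} gens zero m = coeff , trans (cong (m * gens zero +_) (rest-zero (λ i → gens (suc i)))) (+-identityʳ _)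
  where
  coeff : Fin (suc n) → ℕ
  coeff zero = m
  coeff (suc _) = 0
  rest-zero : ∀ {r} (f : Fin r → ℕ) → sumFin (λ i → 0 * f i) ≡ 0
  rest-zero {zero} f = refl
  rest-zero {suc r} f = rest-zero (λ i → f (suc i))
multiple∈semigroup {suc n} gens (suc l) m with multiple∈semigroup (λ i → gens (suc i)) l m
... | coeff , sum≡ = (λ { zero → 0 ; (suc i) → coeff i }) , sum≡

corollary3p11 : (k : ℕ) (a b : Fin k → ℕ) → Positive a → Positive b → Suitable k a b →
    Smooth k (compound k a b) × ((j : Fin k) → cval (compound k a b) j ≡ a j)
corollary3p11 k a b pos-a _ suitable = smooth , cval-compound k a b suitable pos-a
  where
  g : Fin (suc k) → ℕ
  g = compound k a b
  -- c_{j+1} g_{j+1} = a_{j+1} g_{j+1} = b_{j+1} g_j, and g_j is the last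
  -- entry of the prefix g_0, …, g_j.
  smooth : Smooth k g
  smooth j with multiple∈semigroup (prefix g (suc j)) (fromℕ (toℕ j)) (b j)
  ... | coeff , sum≡ = coeff , (begin
    sumFin (λ l → coeff l * prefix g (suc j) l) ≡⟨ sum≡ ⟩
    b j * prefix g (suc j) (fromℕ (toℕ j))
      ≡⟨ cong (λ i → b j * (prodFirst b i * prodAfter a i)) last-index ⟩
    b j * g (inject₁ j)                 ≡⟨ sym (compound-shift k a b j) ⟩
    a j * g (suc j)                     ≡⟨ cong (_* g (suc j)) (sym (cval-compound k a b suitable pos-a j)) ⟩
    cval g j * g (suc j)                ∎)
    where
    last-index : toℕ (inject≤ (fromℕ (toℕ j)) (<⇒≤ (toℕ<n (suc j)))) ≡ toℕ (inject₁ j)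
    last-index = trans (toℕ-inject≤ (fromℕ (toℕ j)) _) (trans (toℕ-fromℕ (toℕ j)) (sym (toℕ-inject₁ j)))
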